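{- Let $G$ be a finite, simple, connected graph that is self-centered and not complete. Then $E_2(G)\geq E_1(G)$, with equality if and only if $G$ is a cycle.
   Context: For a connected graph $G$ and $v\in V(G)$, the eccentricity is $\varepsilon_G(v)=\max_{u\in V(G)} d_G(v,u)$. The diameter is ${\rm diam}(G)=\max_v \varepsilon_G(v)$ and the radius is ${\rm rad}(G)=\min_v\varepsilon_G(v)$. $G$ is self-centered if ${\rm diam}(G)={\rm rad}(G)$. The first and second Zagreb eccentricity indices are $E_1(G)=\sum_{v\in V(G)}\varepsilon_G(v)^2$ and $E_2(G)=\sum_{uv\in E(G)}\varepsilon_G(u)\varepsilon_G(v)$. -}

module Defs where

open import Data.Nat using (ℕ; zero; suc; _+_; _*_; _<ᵇ_; _≡ᵇ_; _⊔_; _⊓_; _≤_)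
open import Data.Bool using (Bool; true; false; _∧_; _∨_; if_then_else_)
open import Data.Fin using (Fin; toℕ; _≟_)
open import Data.List using (List; allFin; map; foldr)
open import Data.Bool.ListAction using (any)
open import Data.Nat.ListAction using (sum)
open import Data.Fin.Permutation using (Permutation′; _⟨$⟩ʳ_)
open import Data.Product using (Σ; _×_)
open import Relation.Nullary using (¬_)
open import Relation.Nullary.Decidable using (⌊_⌋)
open import Relation.Binary.PropositionalEquality using (_≡_; _≢_)

record Graph (n : ℕ) : Set where
  field
    adj    : Fin n → Fin n → Bool
    sym    : ∀ i j → adj i j ≡ adj j i
    irrefl : ∀ i → adj i i ≡ false
open Graph public

module _ {n : ℕ} (G : Graph n) where

  data Walk : Fin n → Fin n → Set where
    here : ∀ {u} → Walk u u
    step : ∀ {u w v} → adj G u w ≡ true → Walk w v → Walk u v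

  Connected : Set
  Connected = ∀ u v → Walk u v

  Complete : Set
  Complete = ∀ i j → i ≢ j → adj G i j ≡ true

  reach : ℕ → Fin n → Fin n → Bool
  reach zero    u v = ⌊ u ≟ v ⌋
  reach (suc k) u v = reach k u v ∨ any (λ w → adj G u w ∧ reach k w v) (allFin n)

  search : Fin n → Fin n → ℕ → ℕ → ℕ
  search u v k zero       = k
  search u v k (suc fuel) = if reach k u v then k else search u v (suc k) fuel

  -- distance d_G(u,v): length of a shortest walk (every shortest walk has length < n)
  dist : Fin n → Fin n → ℕ
  dist u v = search u v 0 n

  ecc : Fin n → ℕ
  ecc v = foldr _⊔_ 0 (map (dist v) (allFin n))

  diam : ℕ
  diam = foldr _⊔_ 0 (map ecc (allFin n))

  -- minimum of the eccentricities (diam is an upper bound on all of them)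
  rad : ℕ
  rad = foldr _⊓_ diam (map ecc (allFin n))

  SelfCentered : Set
  SelfCentered = diam ≡ rad

  E₁ : ℕ
  E₁ = sum (map (λ v → ecc v * ecc v) (allFin n))

  -- sum over edges uv (each unordered edge counted once, via toℕ u < toℕ v)
  E₂ : ℕ
  E₂ = sum (map (λ u → sum (map (λ v → if (toℕ u <ᵇ toℕ v) ∧ adj G u v
                                         then ecc u * ecc v else 0)
                                (allFin n)))
                (allFin n))

cycleAdj : (n : ℕ) → Fin n → Fin n → Bool
cycleAdj n i j =
  (suc (toℕ i) ≡ᵇ toℕ j) ∨ (suc (toℕ j) ≡ᵇ toℕ i)
  ∨ ((toℕ i ≡ᵇ 0) ∧ (suc (toℕ j) ≡ᵇ n)) ∨ ((toℕ j ≡ᵇ 0) ∧ (suc (toℕ i) ≡ᵇ n))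

IsCycle : {n : ℕ} → Graph n → Set
IsCycle {n} G = (3 ≤ n) × Σ (Permutation′ n) (λ π →
  ∀ i j → adj G (π ⟨$⟩ʳ i) (π ⟨$⟩ʳ j) ≡ cycleAdj n i j)

-- Self-centredness makes every eccentricity equal to the diameter d, so E₁ = n·d² and
-- E₂ = m·d² with m the number of edges; it remains to compare m with n. A non-adjacent pair
-- gives d ≥ 2, and then every degree is at least 2: if u were the only neighbour of v, every
-- shortest path from v would pass through u, giving ecc u < ecc v. Hence 2m = Σ deg ≥ 2n, with
-- equality exactly for 2-regular graphs. A cycle is 2-regular; conversely, in a connected
-- 2-regular graph a walk that never steps back first revisits a vertex at its start, and the
-- closed trail it traces exhausts the graph (it is closed under adjacency), so it is a cycle.

module Submission where

open import Defs renaming (sym to adj-sym)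

import Data.Nat as ℕ
open import Data.Nat
  using (ℕ; zero; suc; _+_; _*_; _≤_; _<_; z≤n; s≤s; _≡ᵇ_; _<ᵇ_; _⊔_; _⊓_; NonZero; >-nonZero)
open import Data.Nat.Properties
  using ( +-*-semiring; +-comm; +-assoc; +-suc; +-identityʳ; +-mono-≤; +-monoʳ-≤; +-cancelˡ-≡; +-cancelʳ-≤
        ; *-comm; *-zeroʳ; *-mono-≤; *-monoˡ-≤; *-cancelˡ-≤; *-cancelˡ-≡; *-cancelʳ-≡
        ; ≤-refl; ≤-trans; ≤-antisym; ≤-pred; <-irrefl; <⇒≢; ≤∧≢⇒<; n≤1+n; m≤n⇒m≤1+n; m≤n⇒m<n∨m≡n
        ; suc-injective; ≡ᵇ⇒≡; ≡⇒≡ᵇ; m≤m⊔n; m≤n⊔m; ⊔-lub; m⊓n≤m; m⊓n≤n; module ≤-Reasoning )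
import Data.Nat.ListAction as List
import Algebra.Properties.Semiring.Sum as SemiringSum
import Data.Bool as Bool
open import Data.Bool using (Bool; true; false; _∧_; _∨_; if_then_else_; T)
open import Data.Bool.Properties using (T-∨; T-∧; T-≡; ¬-not; ∨-assoc; ∨-comm)
open import Data.Fin using (Fin; zero; suc; toℕ; _≟_; fromℕ<)
open import Data.Fin.Properties using (toℕ-injective; toℕ-fromℕ<; toℕ<n; injective⇒≤; any?; ¬∀⟶∃¬)
open import Data.Fin.Permutation using (Permutation′; permutation; _⟨$⟩ʳ_; _⟨$⟩ˡ_; inverseʳ)
open import Data.Vec.Functional using (updateAt)
open import Data.Vec.Functional.Properties using (updateAt-updates; updateAt-minimal)
open import Data.List using (List; []; _∷_; map; allFin; tabulate; length; lookup; foldr)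
open import Data.List.Properties using (map-tabulate; map-cong-local)
import Data.List.Relation.Unary.Any as Any
open Any using (here; there)
open import Data.List.Relation.Unary.Any.Properties using (any⁺; any⁻)
import Data.List.Relation.Unary.All as All
open All using (All; []; _∷_)
open import Data.List.Relation.Unary.All.Properties using (¬Any⇒All¬)
open import Data.List.Relation.Unary.Unique.Propositional using (Unique; []; _∷_)
open import Data.List.Membership.Propositional using (_∈_)
open import Data.List.Membership.Propositional.Properties using (∈-lookup; ∈-allFin)
open import Data.Product using (Σ; _×_; _,_; proj₁; proj₂)
open import Data.Sum using (_⊎_; inj₁; inj₂)
open import Data.Empty using (⊥; ⊥-elim)
open import Function using (_∘_)
open import Function.Bundles using (_⇔_; mk⇔; Equivalence)
open import Relation.Nullary using (¬_; yes; no)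
open import Relation.Nullary.Decidable using (toWitness; fromWitness; ¬?; _×-dec_)
open import Relation.Binary.PropositionalEquality
  using (_≡_; _≢_; refl; sym; trans; cong; cong₂; subst; subst₂; ≢-sym; module ≡-Reasoning)

open SemiringSum +-*-semiring
  using (sum; sum-syntax; sum-cong-≗; ∑-comm; ∑-distrib-+; ∑-permute; *-distribʳ-sum)

χ : Bool → ℕ
χ true  = 1
χ false = 0

χ≤1 : ∀ b → χ b ≤ 1
χ≤1 true  = ≤-refl
χ≤1 false = z≤n

count : ∀ {n} → (Fin n → Bool) → ℕ
count {n} p = ∑[ j < n ] χ (p j)

count-cong : ∀ {n} {p q : Fin n → Bool} → (∀ j → p j ≡ q j) → count p ≡ count q
count-cong p≡q = sum-cong-≗ (λ j → cong χ (p≡q j))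

sum-allFin : ∀ n (f : Fin n → ℕ) → List.sum (map f (allFin n)) ≡ sum f
sum-allFin n f = trans (cong List.sum (map-tabulate (λ i → i) f)) (go n f)
  where
  go : ∀ n (f : Fin n → ℕ) → List.sum (tabulate f) ≡ sum f
  go zero    f = refl
  go (suc n) f = cong (f zero +_) (go n (λ i → f (suc i)))

∑-const : ∀ n c → ∑[ i < n ] c ≡ n * c
∑-const zero    c = refl
∑-const (suc n) c = cong (c +_) (∑-const n c)

∑-2 : ∀ n → ∑[ i < n ] 2 ≡ 2 * n
∑-2 n = trans (∑-const n 2) (*-comm n 2)

∑-mono-≤ : ∀ {n} {f g : Fin n → ℕ} → (∀ i → f i ≤ g i) → sum f ≤ sum g
∑-mono-≤ {zero}  f≤g = z≤n
∑-mono-≤ {suc n} f≤g = +-mono-≤ (f≤g zero) (∑-mono-≤ (λ i → f≤g (suc i)))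

∑-*ʳ : ∀ {n} (f : Fin n → ℕ) c → ∑[ i < n ] (f i * c) ≡ sum f * c
∑-*ʳ f c = sym (*-distribʳ-sum c f)

∑-mono-≤-≡⇒≡ : ∀ {n} {f g : Fin n → ℕ} → (∀ i → f i ≤ g i) → sum f ≡ sum g → ∀ i → f i ≡ g i
∑-mono-≤-≡⇒≡ {suc n} {f} {g} f≤g ∑f≡∑g = pointwise
  where
  rest-≤ : ∑[ i < n ] f (suc i) ≤ ∑[ i < n ] g (suc i)
  rest-≤ = ∑-mono-≤ (λ i → f≤g (suc i))
  head-≡ : f zero ≡ g zero
  head-≡ = ≤-antisym (f≤g zero) (+-cancelʳ-≤ (∑[ i < n ] g (suc i)) (g zero) (f zero) (begin
    g zero + ∑[ i < n ] g (suc i)  ≡⟨ sym ∑f≡∑g ⟩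
    f zero + ∑[ i < n ] f (suc i)  ≤⟨ +-monoʳ-≤ (f zero) rest-≤ ⟩
    f zero + ∑[ i < n ] g (suc i)  ∎))
    where open ≤-Reasoning
  rest-≡ : ∑[ i < n ] f (suc i) ≡ ∑[ i < n ] g (suc i)
  rest-≡ = +-cancelˡ-≡ (f zero) _ _ (trans ∑f≡∑g (cong (_+ _) (sym head-≡)))
  pointwise : ∀ i → f i ≡ g i
  pointwise zero    = head-≡
  pointwise (suc i) = ∑-mono-≤-≡⇒≡ (λ j → f≤g (suc j)) rest-≡ i

∑-updateAt-0 : ∀ {n} (f : Fin n → ℕ) i → sum f ≡ f i + sum (updateAt f i (λ _ → 0))
∑-updateAt-0 f zero    = refl
∑-updateAt-0 f (suc i) = begin
  f zero + ∑[ j < _ ] f (suc j)  ≡⟨ cong (f zero +_) (∑-updateAt-0 (λ j → f (suc j)) i) ⟩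
  f zero + (f (suc i) + rest)    ≡⟨ sym (+-assoc (f zero) _ rest) ⟩
  f zero + f (suc i) + rest      ≡⟨ cong (_+ rest) (+-comm (f zero) _) ⟩
  f (suc i) + f zero + rest      ≡⟨ +-assoc (f (suc i)) _ rest ⟩
  f (suc i) + (f zero + rest)    ∎
  where
  open ≡-Reasoning
  rest = sum (updateAt (λ j → f (suc j)) i (λ _ → 0))

∑-zero : ∀ {n} {f : Fin n → ℕ} → (∀ i → f i ≡ 0) → sum f ≡ 0
∑-zero {n} f≡0 = trans (sum-cong-≗ f≡0) (trans (∑-const n 0) (*-zeroʳ n))

sum-map≤∑-Unique : ∀ {n} (f : Fin n → ℕ) {xs} → Unique xs → List.sum (map f xs) ≤ sum f
sum-map≤∑-Unique f [] = z≤n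
sum-map≤∑-Unique f {x ∷ xs} (x∉xs ∷ xs-unique) = begin
  f x + List.sum (map f xs)   ≡⟨ cong (λ ys → f x + List.sum ys) (map-cong-local agree) ⟩
  f x + List.sum (map f′ xs)  ≤⟨ +-monoʳ-≤ (f x) (sum-map≤∑-Unique f′ xs-unique) ⟩
  f x + sum f′                ≡⟨ sym (∑-updateAt-0 f x) ⟩
  sum f                       ∎
  where
  open ≤-Reasoning
  f′ = updateAt f x (λ _ → 0)
  agree : All (λ y → f y ≡ f′ y) xs
  agree = All.map (λ x≢y → sym (updateAt-minimal _ x f (≢-sym x≢y))) x∉xs

length≤count : ∀ {n} (p : Fin n → Bool) {xs} → Unique xs → All (λ x → p x ≡ true) xs → length xs ≤ count p
length≤count p {xs} xs-unique all-p =
  subst (_≤ count p) (sum-χ-true all-p) (sum-map≤∑-Unique (λ j → χ (p j)) xs-unique)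
  where
  sum-χ-true : ∀ {ys} → All (λ y → p y ≡ true) ys → List.sum (map (λ y → χ (p y)) ys) ≡ length ys
  sum-χ-true []             = refl
  sum-χ-true (py≡true ∷ ps) = cong₂ _+_ (cong χ py≡true) (sum-χ-true ps)

count-single : ∀ {n} (p : Fin n → Bool) i → (∀ j → p j ≡ true → j ≡ i) → count p ≡ χ (p i)
count-single p i only-i = begin
  count p                                  ≡⟨ ∑-updateAt-0 (λ j → χ (p j)) i ⟩
  χ (p i) + sum (updateAt χp i (λ _ → 0))  ≡⟨ cong (χ (p i) +_) (∑-zero vanishes) ⟩
  χ (p i) + 0                              ≡⟨ +-identityʳ _ ⟩
  χ (p i)                                  ∎
  where
  open ≡-Reasoning
  χp : Fin _ → ℕ
  χp j = χ (p j)
  vanishes : ∀ j → updateAt χp i (λ _ → 0) j ≡ 0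
  vanishes j with j ≟ i
  ... | yes refl = updateAt-updates i _
  ... | no j≢i with p j in pj
  ...   | true  = ⊥-elim (j≢i (only-i j pj))
  ...   | false = trans (updateAt-minimal j i _ j≢i) (cong χ pj)

χ-∨-disjoint : ∀ a b → (a ≡ true → b ≡ true → ⊥) → χ (a ∨ b) ≡ χ a + χ b
χ-∨-disjoint true  true  a⊥b = ⊥-elim (a⊥b refl refl)
χ-∨-disjoint true  false _   = refl
χ-∨-disjoint false b     _   = refl

count-∨-disjoint : ∀ {n} (p q : Fin n → Bool) → (∀ j → p j ≡ true → q j ≡ true → ⊥) →
                   count (λ j → p j ∨ q j) ≡ count p + count q
count-∨-disjoint p q disjoint =
  trans (sum-cong-≗ (λ j → χ-∨-disjoint (p j) (q j) (disjoint j)))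
        (∑-distrib-+ (λ j → χ (p j)) (λ j → χ (q j)))

if-then-0≡χ* : ∀ b x → (if b then x else 0) ≡ χ b * x
if-then-0≡χ* true  x = sym (+-identityʳ x)
if-then-0≡χ* false x = refl

χ-split-<ᵇ : ∀ a b x → (a ≡ b → x ≡ false) → χ x ≡ χ ((a <ᵇ b) ∧ x) + χ ((b <ᵇ a) ∧ x)
χ-split-<ᵇ zero    zero    x a≡b⇒¬x rewrite a≡b⇒¬x refl = refl
χ-split-<ᵇ zero    (suc b) x _      = sym (+-identityʳ (χ x))
χ-split-<ᵇ (suc a) zero    x _      = refl
χ-split-<ᵇ (suc a) (suc b) x a≡b⇒¬x = χ-split-<ᵇ a b x (λ a≡b → a≡b⇒¬x (cong suc a≡b))

∨≡true⇒ : ∀ a {b} → a ∨ b ≡ true → a ≡ true ⊎ b ≡ true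
∨≡true⇒ true  _ = inj₁ refl
∨≡true⇒ false b = inj₂ b

χ-mono : ∀ {a b} → (a ≡ true → b ≡ true) → χ a ≤ χ b
χ-mono {true}  a⇒b rewrite a⇒b refl = ≤-refl
χ-mono {false} _   = z≤n

χ-injective : ∀ {a b} → χ a ≡ χ b → a ≡ b
χ-injective {true}  {true}  _ = refl
χ-injective {false} {false} _ = refl

count-mono-≡⇒≡ : ∀ {n} {p q : Fin n → Bool} → (∀ j → p j ≡ true → q j ≡ true) →
                 count p ≡ count q → ∀ j → p j ≡ q j
count-mono-≡⇒≡ p⇒q count≡ j = χ-injective (∑-mono-≤-≡⇒≡ (λ i → χ-mono (p⇒q i)) count≡ j)

-- Degrees, edges and the Zagreb eccentricity indices

module _ {n : ℕ} (G : Graph n) where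

  degree : Fin n → ℕ
  degree v = count (adj G v)

  edgeCount : ℕ
  edgeCount = ∑[ u < n ] count (λ v → (toℕ u <ᵇ toℕ v) ∧ adj G u v)

  handshake : sum degree ≡ 2 * edgeCount
  handshake = begin
    sum degree                                   ≡⟨ sum-cong-≗ split ⟩
    ∑[ u < n ] (forward u + backward u)          ≡⟨ ∑-distrib-+ forward backward ⟩
    edgeCount + ∑[ u < n ] backward u            ≡⟨ cong (edgeCount +_) backward-total ⟩
    edgeCount + edgeCount                        ≡⟨ cong (edgeCount +_) (sym (+-identityʳ edgeCount)) ⟩
    2 * edgeCount                                ∎
    where
    open ≡-Reasoning
    forward backward : Fin n → ℕ
    forward  u = count (λ v → (toℕ u <ᵇ toℕ v) ∧ adj G u v)
    backward u = count (λ v → (toℕ v <ᵇ toℕ u) ∧ adj G u v)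
    split : ∀ u → degree u ≡ forward u + backward u
    split u = trans (sum-cong-≗ (λ v → χ-split-<ᵇ (toℕ u) (toℕ v) (adj G u v) (no-loop v)))
                    (∑-distrib-+ (λ v → χ ((toℕ u <ᵇ toℕ v) ∧ adj G u v))
                                 (λ v → χ ((toℕ v <ᵇ toℕ u) ∧ adj G u v)))
      where
      no-loop : ∀ v → toℕ u ≡ toℕ v → adj G u v ≡ false
      no-loop v u≡v = subst (λ w → adj G u w ≡ false) (toℕ-injective u≡v) (irrefl G u)
    backward-total : ∑[ u < n ] backward u ≡ edgeCount
    backward-total =
      trans (sum-cong-≗ (λ u → sum-cong-≗ (λ v → cong (λ b → χ ((toℕ v <ᵇ toℕ u) ∧ b)) (adj-sym G u v))))
            (∑-comm (λ u v → χ ((toℕ v <ᵇ toℕ u) ∧ adj G v u)))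

  order≤edgeCount : (∀ v → 2 ≤ degree v) → n ≤ edgeCount
  order≤edgeCount 2≤deg = *-cancelˡ-≤ 2 (begin
    2 * n           ≡⟨ sym (∑-2 n) ⟩
    ∑[ v < n ] 2    ≤⟨ ∑-mono-≤ 2≤deg ⟩
    sum degree      ≡⟨ handshake ⟩
    2 * edgeCount   ∎)
    where open ≤-Reasoning

  edgeCount≡order⇒2-regular : (∀ v → 2 ≤ degree v) → edgeCount ≡ n → ∀ v → degree v ≡ 2
  edgeCount≡order⇒2-regular 2≤deg m≡n v = sym (∑-mono-≤-≡⇒≡ 2≤deg (begin
    ∑[ v < n ] 2    ≡⟨ ∑-2 n ⟩
    2 * n           ≡⟨ cong (2 *_) (sym m≡n) ⟩
    2 * edgeCount   ≡⟨ sym handshake ⟩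
    sum degree      ∎) v)
    where open ≡-Reasoning

  2-regular⇒edgeCount≡order : (∀ v → degree v ≡ 2) → edgeCount ≡ n
  2-regular⇒edgeCount≡order deg≡2 = *-cancelˡ-≡ edgeCount n 2 (begin
    2 * edgeCount   ≡⟨ sym handshake ⟩
    sum degree      ≡⟨ sum-cong-≗ deg≡2 ⟩
    ∑[ v < n ] 2    ≡⟨ ∑-2 n ⟩
    2 * n           ∎)
    where open ≡-Reasoning

  E₁-constant : ∀ {d} → (∀ v → ecc G v ≡ d) → E₁ G ≡ n * (d * d)
  E₁-constant {d} ecc≡d = begin
    E₁ G                            ≡⟨ sum-allFin n _ ⟩
    ∑[ v < n ] (ecc G v * ecc G v)  ≡⟨ sum-cong-≗ (λ v → cong₂ _*_ (ecc≡d v) (ecc≡d v)) ⟩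
    ∑[ v < n ] (d * d)              ≡⟨ ∑-const n (d * d) ⟩
    n * (d * d)                     ∎
    where open ≡-Reasoning

  E₂-constant : ∀ {d} → (∀ v → ecc G v ≡ d) → E₂ G ≡ edgeCount * (d * d)
  E₂-constant {d} ecc≡d = begin
    E₂ G                                            ≡⟨ sum-allFin n _ ⟩
    ∑[ u < n ] List.sum (map (term u) (allFin n))   ≡⟨ sum-cong-≗ row ⟩
    ∑[ u < n ] (count (edge u) * (d * d))           ≡⟨ ∑-*ʳ (λ u → count (edge u)) (d * d) ⟩
    edgeCount * (d * d)                             ∎
    where
    open ≡-Reasoning
    edge : Fin n → Fin n → Bool
    edge u v = (toℕ u <ᵇ toℕ v) ∧ adj G u v
    term : Fin n → Fin n → ℕ
    term u v = if edge u v then ecc G u * ecc G v else 0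
    row : ∀ u → List.sum (map (term u) (allFin n)) ≡ count (edge u) * (d * d)
    row u = begin
      List.sum (map (term u) (allFin n))  ≡⟨ sum-allFin n _ ⟩
      ∑[ v < n ] term u v                 ≡⟨ sum-cong-≗ (λ v → trans
                                              (cong (λ x → if edge u v then x else 0) (cong₂ _*_ (ecc≡d u) (ecc≡d v)))
                                              (if-then-0≡χ* (edge u v) (d * d))) ⟩
      ∑[ v < n ] (χ (edge u v) * (d * d)) ≡⟨ ∑-*ʳ (λ v → χ (edge u v)) (d * d) ⟩
      count (edge u) * (d * d)            ∎

-- Walks and distances

Unique-length≤ : ∀ {n} {xs : List (Fin n)} → Unique xs → length xs ≤ n
Unique-length≤ {xs = xs} xs-unique = injective⇒≤ (λ {i} {j} → lookup-injective xs-unique i j)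
  where
  lookup-injective : ∀ {ys : List (Fin _)} → Unique ys → ∀ i j → lookup ys i ≡ lookup ys j → i ≡ j
  lookup-injective (y∉ ∷ _) zero    zero    _  = refl
  lookup-injective (y∉ ∷ _) zero    (suc j) eq = ⊥-elim (All.lookup y∉ (∈-lookup j) eq)
  lookup-injective (y∉ ∷ _) (suc i) zero    eq = ⊥-elim (All.lookup y∉ (∈-lookup i) (sym eq))
  lookup-injective (_ ∷ u)  (suc i) (suc j) eq = cong suc (lookup-injective u i j eq)

module _ {n : ℕ} {G : Graph n} where

  walkLength : ∀ {u v} → Walk G u v → ℕ
  walkLength here       = 0
  walkLength (step _ p) = suc (walkLength p)

  vertices : ∀ {u v} → Walk G u v → List (Fin n)
  vertices {u} here       = u ∷ []
  vertices {u} (step _ p) = u ∷ vertices p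

  length-vertices : ∀ {u v} (p : Walk G u v) → length (vertices p) ≡ suc (walkLength p)
  length-vertices here       = refl
  length-vertices (step _ p) = cong suc (length-vertices p)

  SimpleWalk : Fin n → Fin n → Set
  SimpleWalk u v = Σ (Walk G u v) (λ p → Unique (vertices p))

  suffixFrom : ∀ {x u v} (p : Walk G x v) → u ∈ vertices p → Unique (vertices p) → SimpleWalk u v
  suffixFrom here       (here refl) p-unique       = here , p-unique
  suffixFrom (step e p) (here refl) p-unique       = step e p , p-unique
  suffixFrom (step _ p) (there u∈p) (_ ∷ p-unique) = suffixFrom p u∈p p-unique

  simplify : ∀ {u v} → Walk G u v → SimpleWalk u v
  simplify here = here , [] ∷ []
  simplify {u} (step u~w p) with simplify p
  ... | q , q-unique with Any.any? (u ≟_) (vertices q)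
  ...   | yes u∈q = suffixFrom q u∈q q-unique
  ...   | no  u∉q = step u~w q , ¬Any⇒All¬ (vertices q) u∉q ∷ q-unique

  shortWalk : ∀ {u v} → Walk G u v → Σ (Walk G u v) (λ p → walkLength p < n)
  shortWalk p with simplify p
  ... | q , q-unique = q , subst (_≤ n) (length-vertices q) (Unique-length≤ q-unique)

  reach-suc : ∀ {k u v} → T (reach G k u v) → T (reach G (suc k) u v)
  reach-suc {k} {u} {v} r = Equivalence.from (T-∨ {reach G k u v}) (inj₁ r)

  reach-refl : ∀ k u → T (reach G k u u)
  reach-refl zero    u = fromWitness refl
  reach-refl (suc k) u = reach-suc {k} {u} {u} (reach-refl k u)

  walk⇒reach : ∀ {u v k} (p : Walk G u v) → walkLength p ≤ k → T (reach G k u v)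
  walk⇒reach {u} {k = k} here _ = reach-refl k u
  walk⇒reach {u} {v} {suc k} (step {w = w} u~w p) (s≤s p≤k) =
    Equivalence.from (T-∨ {reach G k u v}) (inj₂ (any⁺ _ (Any.map via-w (∈-allFin w))))
    where
    via-w : ∀ {x} → w ≡ x → T (adj G u x ∧ reach G k x v)
    via-w refl = Equivalence.from (T-∧ {adj G u w}) (Equivalence.from T-≡ u~w , walk⇒reach p p≤k)

  reach-suc⁻ : ∀ {k u v} → T (reach G (suc k) u v) →
               T (reach G k u v) ⊎ Σ (Fin n) (λ w → adj G u w ≡ true × T (reach G k w v))
  reach-suc⁻ {k} {u} {v} r with Equivalence.to (T-∨ {reach G k u v}) r
  ... | inj₁ r′ = inj₁ r′
  ... | inj₂ r′ with Any.satisfied (any⁻ _ (allFin n) r′)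
  ...   | w , t with Equivalence.to (T-∧ {adj G u w}) t
  ...     | u~w , w⇝v = inj₂ (w , Equivalence.to T-≡ u~w , w⇝v)

  search-≤ : ∀ {u v j} k fuel → k ≤ j → T (reach G j u v) → search G u v k fuel ≤ j
  search-≤ k zero k≤j _ = k≤j
  search-≤ {u} {v} {j} k (suc fuel) k≤j r with reach G k u v in eq
  ... | true = k≤j
  ... | false with k ℕ.≟ j
  ...   | yes refl = ⊥-elim (subst T eq r)
  ...   | no k≢j   = search-≤ (suc k) fuel (≤∧≢⇒< k≤j k≢j) r

  search-reaches : ∀ {u v j} k fuel → k ≤ j → j < k + fuel → T (reach G j u v) →
                   T (reach G (search G u v k fuel) u v)
  search-reaches {j = j} k zero k≤j j<k+0 _ =
    ⊥-elim (<-irrefl refl (≤-trans j<k+0 (subst (_≤ j) (sym (+-identityʳ k)) k≤j)))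
  search-reaches {u} {v} {j} k (suc fuel) k≤j j<k+fuel r with reach G k u v in eq
  ... | true = Equivalence.from T-≡ eq
  ... | false with k ℕ.≟ j
  ...   | yes refl = ⊥-elim (subst T eq r)
  ...   | no k≢j   = search-reaches (suc k) fuel (≤∧≢⇒< k≤j k≢j) (subst (j <_) (+-suc k fuel) j<k+fuel) r

  dist-≤ : ∀ {u v j} → T (reach G j u v) → dist G u v ≤ j
  dist-≤ = search-≤ 0 n z≤n

  dist-≤-walkLength : ∀ {u v} (p : Walk G u v) → dist G u v ≤ walkLength p
  dist-≤-walkLength {u} {v} p = dist-≤ {u} {v} {walkLength p} (walk⇒reach p ≤-refl)

  -- dist searches only the lengths below n, so a connecting walk is first shortened below n.
  reach-dist : Connected G → ∀ u v → T (reach G (dist G u v) u v)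
  reach-dist connected u v with shortWalk (connected u v)
  ... | p , p<n = search-reaches 0 n z≤n p<n (walk⇒reach p ≤-refl)

  first-step : ∀ {u v} k → T (reach G k u v) → u ≢ v →
               Σ (Fin n) (λ w → adj G u w ≡ true × suc (dist G w v) ≤ k)
  first-step zero    r u≢v = ⊥-elim (u≢v (toWitness r))
  first-step {u} {v} (suc k) r u≢v with reach-suc⁻ {k} {u} {v} r
  ... | inj₂ (w , u~w , w⇝v) = w , u~w , s≤s (dist-≤ {w} {v} {k} w⇝v)
  ... | inj₁ r′ with first-step k r′ u≢v
  ...   | w , u~w , closer = w , u~w , m≤n⇒m≤1+n closer

  shortest-first-step : Connected G → ∀ {u v} → u ≢ v →
                        Σ (Fin n) (λ w → adj G u w ≡ true × suc (dist G w v) ≤ dist G u v)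
  shortest-first-step connected {u} {v} = first-step (dist G u v) (reach-dist connected u v)

  1≤dist : Connected G → ∀ {u v} → u ≢ v → 1 ≤ dist G u v
  1≤dist connected u≢v = ≤-trans (s≤s z≤n) (proj₂ (proj₂ (shortest-first-step connected u≢v)))

-- Eccentricities and the minimum degree

foldr-⊔-upper : ∀ {A : Set} (f : A → ℕ) {x} xs → x ∈ xs → f x ≤ foldr _⊔_ 0 (map f xs)
foldr-⊔-upper f (y ∷ ys) (here refl) = m≤m⊔n (f y) _
foldr-⊔-upper f (y ∷ ys) (there x∈ys) = ≤-trans (foldr-⊔-upper f ys x∈ys) (m≤n⊔m (f y) _)

foldr-⊔-least : ∀ {A : Set} (f : A → ℕ) {b} xs → (∀ x → f x ≤ b) → foldr _⊔_ 0 (map f xs) ≤ b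
foldr-⊔-least f []       f≤b = z≤n
foldr-⊔-least f (y ∷ ys) f≤b = ⊔-lub (f≤b y) (foldr-⊔-least f ys f≤b)

foldr-⊓-lower : ∀ {A : Set} (f : A → ℕ) z {x} xs → x ∈ xs → foldr _⊓_ z (map f xs) ≤ f x
foldr-⊓-lower f z (y ∷ ys) (here refl) = m⊓n≤m (f y) _
foldr-⊓-lower f z (y ∷ ys) (there x∈ys) = ≤-trans (m⊓n≤n (f y) _) (foldr-⊓-lower f z ys x∈ys)

module _ {n : ℕ} (G : Graph n) where

  dist≤ecc : ∀ v x → dist G v x ≤ ecc G v
  dist≤ecc v x = foldr-⊔-upper (dist G v) (allFin n) (∈-allFin x)

  ecc≤ : ∀ {v b} → (∀ x → dist G v x ≤ b) → ecc G v ≤ b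
  ecc≤ {v} = foldr-⊔-least (dist G v) (allFin n)

  ecc≤diam : ∀ v → ecc G v ≤ diam G
  ecc≤diam v = foldr-⊔-upper (ecc G) (allFin n) (∈-allFin v)

  positive-ecc⇒other-vertex : ∀ {v} → 0 < ecc G v → Σ (Fin n) (v ≢_)
  positive-ecc⇒other-vertex {v} 0<ecc = ¬∀⟶∃¬ n (v ≡_) (v ≟_) λ all≡v →
    <-irrefl refl (≤-trans 0<ecc (ecc≤ λ x →
      subst (λ y → dist G v y ≤ 0) (all≡v x) (dist-≤ {G = G} {j = 0} (reach-refl {G = G} 0 v))))

  SelfCentered⇒ecc≡diam : SelfCentered G → ∀ v → ecc G v ≡ diam G
  SelfCentered⇒ecc≡diam diam≡rad v = ≤-antisym (ecc≤diam v)
    (subst (_≤ ecc G v) (sym diam≡rad) (foldr-⊓-lower (ecc G) (diam G) (allFin n) (∈-allFin v)))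

  nonadjacent-pair : ¬ Complete G → Σ (Fin n) (λ i → Σ (Fin n) (λ j → i ≢ j × adj G i j ≡ false))
  nonadjacent-pair incomplete with any? (λ i → any? (λ j → ¬? (i ≟ j) ×-dec (adj G i j Bool.≟ false)))
  ... | yes (i , j , i≢j , i≁j) = i , j , i≢j , i≁j
  ... | no none = ⊥-elim (incomplete (λ i j i≢j → ¬-not (λ i≁j → none (i , j , i≢j , i≁j))))

  2≤dist-nonadjacent : Connected G → ∀ {i j} → i ≢ j → adj G i j ≡ false → 2 ≤ dist G i j
  2≤dist-nonadjacent connected {i} {j} i≢j i≁j with shortest-first-step connected i≢j
  ... | w , i~w , closer = ≤-trans (s≤s (1≤dist connected w≢j)) closer
    where
    w≢j : w ≢ j
    w≢j refl with () ← trans (sym i~w) i≁j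

  2≤diam : Connected G → ¬ Complete G → 2 ≤ diam G
  2≤diam connected incomplete with nonadjacent-pair incomplete
  ... | i , j , i≢j , i≁j = ≤-trans (2≤dist-nonadjacent connected i≢j i≁j) (≤-trans (dist≤ecc i j) (ecc≤diam i))

  neighbour : Connected G → ∀ {v x} → v ≢ x → Σ (Fin n) (λ w → adj G v w ≡ true)
  neighbour connected {v} {x} v≢x with connected v x
  ... | here       = ⊥-elim (v≢x refl)
  ... | step v~w _ = _ , v~w

  2≤degree : ∀ {v a b} → adj G v a ≡ true → adj G v b ≡ true → a ≢ b → 2 ≤ degree G v
  2≤degree {v} v~a v~b a≢b = length≤count (adj G v) ((a≢b ∷ []) ∷ [] ∷ []) (v~a ∷ v~b ∷ [])

  min-degree-2 : Connected G → ∀ {d} → (∀ v → ecc G v ≡ d) → 2 ≤ d → ∀ v → 2 ≤ degree G v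
  min-degree-2 connected {suc d} ecc≡d (s≤s 1≤d) v with 2 ℕ.≤? degree G v
  ... | yes 2≤deg = 2≤deg
  ... | no  deg≱2 = ⊥-elim (<-irrefl refl (begin-strict
        suc d      ≡⟨ sym (ecc≡d u) ⟩
        ecc G u    ≤⟨ ecc≤ (λ x → ≤-pred (closer x)) ⟩
        d          <⟨ ≤-refl ⟩
        suc d      ∎))
    where
    open ≤-Reasoning
    other : Σ (Fin n) (v ≢_)
    other = positive-ecc⇒other-vertex (subst (0 <_) (sym (ecc≡d v)) (s≤s z≤n))
    u : Fin n
    u = proj₁ (neighbour connected (proj₂ other))
    v~u : adj G v u ≡ true
    v~u = proj₂ (neighbour connected (proj₂ other))
    only-u : ∀ {w} → adj G v w ≡ true → w ≡ u
    only-u {w} v~w with w ≟ u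
    ... | yes w≡u = w≡u
    ... | no  w≢u = ⊥-elim (deg≱2 (2≤degree v~w v~u w≢u))
    closer : ∀ x → suc (dist G u x) ≤ suc d
    closer x with x ≟ v
    ... | yes refl = s≤s (≤-trans (dist-≤-walkLength {G = G} (step (trans (adj-sym G u v) v~u) here)) 1≤d)
    ... | no  x≢v with shortest-first-step connected (x≢v ∘ sym)
    ...   | w , v~w , closer-w = subst (λ y → suc (dist G y x) ≤ suc d) (only-u v~w)
              (≤-trans closer-w (subst (dist G v x ≤_) (ecc≡d v) (dist≤ecc v x)))

Succ : ℕ → ℕ → ℕ → Bool
Succ N a b = (suc a ≡ᵇ b) ∨ ((b ≡ᵇ 0) ∧ (suc a ≡ᵇ N))

Succ⇔ : ∀ N a b → Succ N a b ≡ true ⇔ (suc a ≡ b ⊎ (b ≡ 0 × suc a ≡ N))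
Succ⇔ N a b = mk⇔ to from
  where
  to : Succ N a b ≡ true → suc a ≡ b ⊎ (b ≡ 0 × suc a ≡ N)
  to e with Equivalence.to (T-∨ {suc a ≡ᵇ b}) (Equivalence.from T-≡ e)
  ... | inj₁ t = inj₁ (≡ᵇ⇒≡ (suc a) b t)
  ... | inj₂ t with Equivalence.to (T-∧ {b ≡ᵇ 0}) t
  ...   | t₁ , t₂ = inj₂ (≡ᵇ⇒≡ b 0 t₁ , ≡ᵇ⇒≡ (suc a) N t₂)
  from : suc a ≡ b ⊎ (b ≡ 0 × suc a ≡ N) → Succ N a b ≡ true
  from (inj₁ refl) = Equivalence.to T-≡ (Equivalence.from (T-∨ {suc a ≡ᵇ b}) (inj₁ (≡⇒≡ᵇ b b refl)))
  from (inj₂ (refl , refl)) = Equivalence.to T-≡ (Equivalence.from (T-∨ {suc a ≡ᵇ 0})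
    (inj₂ (Equivalence.from (T-∧ {0 ≡ᵇ 0}) (_ , ≡⇒≡ᵇ N N refl))))

Succ-asymmetric : ∀ {N a b} → 3 ≤ N → Succ N a b ≡ true → Succ N b a ≡ true → ⊥
Succ-asymmetric {N} {a} {b} 3≤N a→b b→a
  with Equivalence.to (Succ⇔ N a b) a→b | Equivalence.to (Succ⇔ N b a) b→a
... | inj₁ refl         | inj₁ 2+a≡a     = <⇒≢ (m≤n⇒m≤1+n ≤-refl) (sym 2+a≡a)
Succ-asymmetric (s≤s (s≤s ())) _ _ | inj₁ refl | inj₂ (refl , refl)
Succ-asymmetric (s≤s (s≤s ())) _ _ | inj₂ (refl , refl) | inj₁ refl
Succ-asymmetric (s≤s ()) _ _ | inj₂ (refl , refl) | inj₂ (refl , _)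

count-toℕ-single : ∀ {N} (p : ℕ → Bool) {c} (c<N : c < N) → p c ≡ true →
                   (∀ m → m < N → p m ≡ true → m ≡ c) → count {N} (λ j → p (toℕ j)) ≡ 1
count-toℕ-single p c<N pc only-c =
  trans (count-single _ (fromℕ< c<N) only) (cong χ (trans (cong p (toℕ-fromℕ< c<N)) pc))
  where
  only : ∀ j → p (toℕ j) ≡ true → j ≡ fromℕ< c<N
  only j pj = toℕ-injective (trans (only-c (toℕ j) (toℕ<n j) pj) (sym (toℕ-fromℕ< c<N)))

count-Succ-out : ∀ {N a} → a < N → count {N} (λ j → Succ N a (toℕ j)) ≡ 1
count-Succ-out {N} {a} a<N with m≤n⇒m<n∨m≡n a<N
... | inj₁ 1+a<N = count-toℕ-single (Succ N a) 1+a<N (Equivalence.from (Succ⇔ N a _) (inj₁ refl)) only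
  where
  only : ∀ m → m < N → Succ N a m ≡ true → m ≡ suc a
  only m _ a→m with Equivalence.to (Succ⇔ N a m) a→m
  ... | inj₁ 1+a≡m       = sym 1+a≡m
  ... | inj₂ (_ , 1+a≡N) = ⊥-elim (<⇒≢ 1+a<N 1+a≡N)
... | inj₂ 1+a≡N = count-toℕ-single (Succ N a) (subst (0 <_) 1+a≡N (s≤s z≤n))
                     (Equivalence.from (Succ⇔ N a 0) (inj₂ (refl , 1+a≡N))) only
  where
  only : ∀ m → m < N → Succ N a m ≡ true → m ≡ 0
  only m m<N a→m with Equivalence.to (Succ⇔ N a m) a→m
  ... | inj₁ 1+a≡m  = ⊥-elim (<⇒≢ m<N (trans (sym 1+a≡m) 1+a≡N))
  ... | inj₂ (m≡0 , _) = m≡0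

count-Succ-in : ∀ {N a} → a < N → count {N} (λ j → Succ N (toℕ j) a) ≡ 1
count-Succ-in {suc N} {zero} _ =
  count-toℕ-single (λ m → Succ (suc N) m 0) ≤-refl
    (Equivalence.from (Succ⇔ (suc N) N 0) (inj₂ (refl , refl))) only
  where
  only : ∀ m → m < suc N → Succ (suc N) m 0 ≡ true → m ≡ N
  only m _ m→0 with Equivalence.to (Succ⇔ (suc N) m 0) m→0
  ... | inj₂ (_ , 1+m≡1+N) = suc-injective 1+m≡1+N
count-Succ-in {N} {suc a} 1+a<N =
  count-toℕ-single (λ m → Succ N m (suc a)) (≤-trans (n≤1+n _) 1+a<N)
    (Equivalence.from (Succ⇔ N a (suc a)) (inj₁ refl)) only
  where
  only : ∀ m → m < N → Succ N m (suc a) ≡ true → m ≡ a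
  only m _ m→1+a with Equivalence.to (Succ⇔ N m (suc a)) m→1+a
  ... | inj₁ 1+m≡1+a = suc-injective 1+m≡1+a

∨-shuffle : ∀ a b c d → (a ∨ b ∨ c ∨ d) ≡ ((a ∨ d) ∨ (b ∨ c))
∨-shuffle true  b c d = refl
∨-shuffle false b c d = trans (sym (∨-assoc b c d)) (∨-comm (b ∨ c) d)

cycleAdj≡Succ : ∀ N i j → cycleAdj N i j ≡ Succ N (toℕ i) (toℕ j) ∨ Succ N (toℕ j) (toℕ i)
cycleAdj≡Succ N i j =
  ∨-shuffle (suc (toℕ i) ≡ᵇ toℕ j) (suc (toℕ j) ≡ᵇ toℕ i)
            ((toℕ i ≡ᵇ 0) ∧ (suc (toℕ j) ≡ᵇ N)) ((toℕ j ≡ᵇ 0) ∧ (suc (toℕ i) ≡ᵇ N))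

cycleAdj-degree : ∀ {N} → 3 ≤ N → ∀ i → count (cycleAdj N i) ≡ 2
cycleAdj-degree {N} 3≤N i = begin
  count (cycleAdj N i)                                    ≡⟨ count-cong (cycleAdj≡Succ N i) ⟩
  count (λ j → out j ∨ into j)    ≡⟨ count-∨-disjoint out into (λ j → Succ-asymmetric {a = a} {b = toℕ j} 3≤N) ⟩
  count out + count into          ≡⟨ cong₂ _+_ (count-Succ-out (toℕ<n i)) (count-Succ-in (toℕ<n i)) ⟩
  2                                                       ∎
  where
  open ≡-Reasoning
  a = toℕ i
  out into : Fin N → Bool
  out  j = Succ N a (toℕ j)
  into j = Succ N (toℕ j) a

IsCycle⇒2-regular : ∀ {n} (G : Graph n) → IsCycle G → ∀ v → degree G v ≡ 2
IsCycle⇒2-regular {n} G (3≤n , π , π-iso) v = begin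
  degree G v                                ≡⟨ cong (degree G) (sym (inverseʳ π)) ⟩
  degree G (π ⟨$⟩ʳ i)                       ≡⟨ ∑-permute (λ w → χ (adj G (π ⟨$⟩ʳ i) w)) π ⟩
  count (λ j → adj G (π ⟨$⟩ʳ i) (π ⟨$⟩ʳ j))  ≡⟨ count-cong (π-iso i) ⟩
  count (cycleAdj n i)                      ≡⟨ cycleAdj-degree 3≤n i ⟩
  2                                         ∎
  where
  open ≡-Reasoning
  i = π ⟨$⟩ˡ v

-- Connected 2-regular graphs are cycles

module _ {n : ℕ} {G : Graph n} (2-regular : ∀ v → degree G v ≡ 2) where

  otherNeighbour : ∀ x y → Σ (Fin n) (λ z → adj G x z ≡ true × z ≢ y)
  otherNeighbour x y with any? (λ z → (adj G x z Bool.≟ true) ×-dec ¬? (z ≟ y))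
  ... | yes found = found
  ... | no  none  = ⊥-elim (<-irrefl refl (begin-strict
        1             <⟨ ≤-refl ⟩
        2             ≡⟨ sym (2-regular x) ⟩
        degree G x    ≡⟨ count-single (adj G x) y only-y ⟩
        χ (adj G x y) ≤⟨ χ≤1 (adj G x y) ⟩
        1             ∎))
    where
    open ≤-Reasoning
    only-y : ∀ z → adj G x z ≡ true → z ≡ y
    only-y z x~z with z ≟ y
    ... | yes z≡y = z≡y
    ... | no  z≢y = ⊥-elim (none (z , x~z , z≢y))

  neighbour-is-one-of : ∀ {x a b z} → adj G x a ≡ true → adj G x b ≡ true → a ≢ b →
                        adj G x z ≡ true → z ≡ a ⊎ z ≡ b
  neighbour-is-one-of {x} {a} {b} {z} x~a x~b a≢b x~z with z ≟ a | z ≟ b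
  ... | yes z≡a | _       = inj₁ z≡a
  ... | no  _   | yes z≡b = inj₂ z≡b
  ... | no  z≢a | no  z≢b = ⊥-elim (<-irrefl refl (subst (3 ≤_) (2-regular x)
        (length≤count (adj G x) ((a≢b ∷ ≢-sym z≢a ∷ []) ∷ (≢-sym z≢b ∷ []) ∷ [] ∷ [])
                                (x~a ∷ x~b ∷ x~z ∷ []))))

  module _ (connected : Connected G) (v₀ : Fin n) where

    trailPair : ℕ → Fin n × Fin n
    trailPair zero    = v₀ , proj₁ (otherNeighbour v₀ v₀)
    trailPair (suc k) with trailPair k
    ... | previous , current = current , proj₁ (otherNeighbour current previous)

    trail : ℕ → Fin n
    trail k = proj₁ (trailPair k)

    trail-step : ∀ k → adj G (trail k) (trail (suc k)) ≡ true
    trail-step zero    = proj₁ (proj₂ (otherNeighbour v₀ v₀))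
    trail-step (suc k) = proj₁ (proj₂ (otherNeighbour (trail (suc k)) (trail k)))

    trail-step˘ : ∀ k → adj G (trail (suc k)) (trail k) ≡ true
    trail-step˘ k = trans (adj-sym G _ _) (trail-step k)

    trail-no-backtrack : ∀ k → trail (suc (suc k)) ≢ trail k
    trail-no-backtrack k = proj₂ (proj₂ (otherNeighbour (trail (suc k)) (trail k)))

    trail-no-stall : ∀ k → trail (suc k) ≢ trail k
    trail-no-stall k eq with () ← trans (sym (trail-step k)) (trans (cong (adj G (trail k)) eq) (irrefl G _))

    trail-neighbours : ∀ k {z} → adj G (trail (suc k)) z ≡ true → z ≡ trail k ⊎ z ≡ trail (suc (suc k))
    trail-neighbours k = neighbour-is-one-of (trail-step˘ k) (trail-step (suc k)) (trail-no-backtrack k ∘ sym)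

    late-return : ∀ j → trail (suc j) ≡ v₀ → 2 ≤ j
    late-return zero          return = ⊥-elim (trail-no-stall 0 return)
    late-return (suc zero)    return = ⊥-elim (trail-no-backtrack 0 return)
    late-return (suc (suc j)) _      = s≤s (s≤s z≤n)

    InjectiveUpTo : ℕ → Set
    InjectiveUpTo J = ∀ {a b} → a ≤ J → b ≤ J → trail a ≡ trail b → a ≡ b

    -- On an injective stretch, the first repeated vertex can only be the start: an earlier
    -- vertex already has both of its neighbours on the trail.
    repeat-is-start : ∀ {j c} → InjectiveUpTo j → c ≤ j → trail (suc j) ≡ trail c → c ≡ 0
    repeat-is-start {j} {zero}   _   _   _      = refl
    repeat-is-start {j} {suc c} inj c≤j repeat
      with trail-neighbours c (subst (λ x → adj G x (trail j) ≡ true) repeat (trail-step˘ j))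
    ... | inj₁ j↦c = ⊥-elim (<-irrefl (sym (inj ≤-refl (≤-trans (n≤1+n c) c≤j) j↦c)) c≤j)
    ... | inj₂ j↦2+c with suc c ℕ.≟ j
    ...   | yes refl = ⊥-elim (trail-no-stall j repeat)
    ...   | no  c≢j  = ⊥-elim (trail-no-backtrack (suc c)
                          (trans (cong (trail ∘ suc) (sym (inj ≤-refl (≤∧≢⇒< c≤j c≢j) j↦2+c))) repeat))

    extend-or-return : ∀ j → InjectiveUpTo j → InjectiveUpTo (suc j) ⊎ trail (suc j) ≡ v₀
    extend-or-return j inj with any? {n = suc j} (λ c → trail (suc j) ≟ trail (toℕ c))
    ... | yes (c , repeat) = inj₂ (trans repeat (cong trail (repeat-is-start inj c≤j repeat)))
      where
      c≤j : toℕ c ≤ j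
      c≤j = ≤-pred (toℕ<n c)
    ... | no fresh = inj₁ inj′
      where
      new : ∀ {b} → b ≤ j → trail (suc j) ≢ trail b
      new b≤j eq = fresh (fromℕ< (s≤s b≤j) , trans eq (cong trail (sym (toℕ-fromℕ< (s≤s b≤j)))))
      inj′ : InjectiveUpTo (suc j)
      inj′ {a} {b} a≤1+j b≤1+j eq with m≤n⇒m<n∨m≡n a≤1+j | m≤n⇒m<n∨m≡n b≤1+j
      ... | inj₁ a≤j | inj₁ b≤j = inj (≤-pred a≤j) (≤-pred b≤j) eq
      ... | inj₂ refl | inj₂ refl = refl
      ... | inj₂ refl | inj₁ b≤j = ⊥-elim (new (≤-pred b≤j) eq)
      ... | inj₁ a≤j | inj₂ refl = ⊥-elim (new (≤-pred a≤j) (sym eq))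

    InjectiveUpTo⇒≤ : ∀ {J} → InjectiveUpTo J → suc J ≤ n
    InjectiveUpTo⇒≤ {J} inj = injective⇒≤ {f = λ (a : Fin (suc J)) → trail (toℕ a)} λ {a} {b} eq →
      toℕ-injective (inj (≤-pred (toℕ<n a)) (≤-pred (toℕ<n b)) eq)

    ClosedTrail : Set
    ClosedTrail = Σ ℕ (λ J → InjectiveUpTo J × trail (suc J) ≡ v₀)

    injective-or-closed : ∀ k → InjectiveUpTo k ⊎ ClosedTrail
    injective-or-closed zero = inj₁ λ { z≤n z≤n _ → refl }
    injective-or-closed (suc k) with injective-or-closed k
    ... | inj₂ closed = inj₂ closed
    ... | inj₁ inj with extend-or-return k inj
    ...   | inj₁ inj′   = inj₁ inj′
    ...   | inj₂ return = inj₂ (k , inj , return)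

    closed-trail : ClosedTrail
    closed-trail with injective-or-closed n
    ... | inj₂ closed = closed
    ... | inj₁ inj    = ⊥-elim (<-irrefl refl (InjectiveUpTo⇒≤ inj))

    module _ (J : ℕ) (inj : InjectiveUpTo J) (return : trail (suc J) ≡ v₀) where

      closing-edge : adj G (trail J) v₀ ≡ true
      closing-edge = subst (λ x → adj G (trail J) x ≡ true) return (trail-step J)

      2≤J : 2 ≤ J
      2≤J = late-return J return

      v₀-neighbours : ∀ {z} → adj G v₀ z ≡ true → z ≡ trail 1 ⊎ z ≡ trail J
      v₀-neighbours = neighbour-is-one-of (trail-step 0) (trans (adj-sym G v₀ (trail J)) closing-edge)
        (λ eq → <-irrefl (inj (≤-trans (s≤s z≤n) 2≤J) ≤-refl eq) 2≤J)

      OnTrail : Fin n → Set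
      OnTrail x = Σ ℕ (λ k → k ≤ J × trail k ≡ x)

      OnTrail-step : ∀ {x z} → OnTrail x → adj G x z ≡ true → OnTrail z
      OnTrail-step (zero , _ , refl) v₀~z with v₀-neighbours v₀~z
      ... | inj₁ z≡1 = 1 , ≤-trans (s≤s z≤n) 2≤J , sym z≡1
      ... | inj₂ z≡J = J , ≤-refl , sym z≡J
      OnTrail-step (suc k , 1+k≤J , refl) x~z with trail-neighbours k x~z
      ... | inj₁ z≡k = k , ≤-trans (n≤1+n k) 1+k≤J , sym z≡k
      ... | inj₂ z≡2+k with m≤n⇒m<n∨m≡n 1+k≤J
      ...   | inj₁ 2+k≤J = suc (suc k) , 2+k≤J , sym z≡2+k
      ...   | inj₂ refl  = 0 , z≤n , sym (trans z≡2+k return)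

      on-trail : ∀ x → OnTrail x
      on-trail x = along (connected v₀ x) (0 , z≤n , refl)
        where
        along : ∀ {y x} → Walk G y x → OnTrail y → OnTrail x
        along here          on-y = on-y
        along (step y~w p) on-y = along p (OnTrail-step on-y y~w)

      index : Fin n → ℕ
      index x = proj₁ (on-trail x)

      index≤J : ∀ x → index x ≤ J
      index≤J x = proj₁ (proj₂ (on-trail x))

      trail-index : ∀ x → trail (index x) ≡ x
      trail-index x = proj₂ (proj₂ (on-trail x))

      n≡1+J : n ≡ suc J
      n≡1+J = ≤-antisym
        (injective⇒≤ {f = λ x → fromℕ< (s≤s (index≤J x))} λ {x} {y} eq → begin
           x                ≡⟨ sym (trail-index x) ⟩
           trail (index x)  ≡⟨ cong trail (trans (sym (toℕ-fromℕ< _)) (trans (cong toℕ eq) (toℕ-fromℕ< _))) ⟩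
           trail (index y)  ≡⟨ trail-index y ⟩
           y                ∎)
        (InjectiveUpTo⇒≤ inj)
        where open ≡-Reasoning

      index<n : ∀ x → index x < n
      index<n x = subst (index x <_) (sym n≡1+J) (s≤s (index≤J x))

      toℕ≤J : ∀ (i : Fin n) → toℕ i ≤ J
      toℕ≤J i = ≤-pred (subst (toℕ i <_) n≡1+J (toℕ<n i))

      ordering : Permutation′ n
      ordering = permutation (λ i → trail (toℕ i)) (λ x → fromℕ< (index<n x)) trail-position position-trail
        where
        trail-position : ∀ x → trail (toℕ (fromℕ< (index<n x))) ≡ x
        trail-position x = trans (cong trail (toℕ-fromℕ< (index<n x))) (trail-index x)
        position-trail : ∀ i → fromℕ< (index<n (trail (toℕ i))) ≡ i
        position-trail i =
          toℕ-injective (trans (toℕ-fromℕ< (index<n x)) (inj (index≤J x) (toℕ≤J i) (trail-index x)))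
          where x = trail (toℕ i)

      Succ⇒adj : ∀ a b → Succ n a b ≡ true → adj G (trail a) (trail b) ≡ true
      Succ⇒adj a b a→b with Equivalence.to (Succ⇔ n a b) a→b
      ... | inj₁ refl          = trail-step a
      ... | inj₂ (refl , 1+a≡n) =
        subst (λ k → adj G (trail k) v₀ ≡ true) (sym (suc-injective (trans 1+a≡n n≡1+J))) closing-edge

      cycleAdj⇒adj : ∀ i j → cycleAdj n i j ≡ true → adj G (ordering ⟨$⟩ʳ i) (ordering ⟨$⟩ʳ j) ≡ true
      cycleAdj⇒adj i j i~j with ∨≡true⇒ (Succ n (toℕ i) (toℕ j)) (trans (sym (cycleAdj≡Succ n i j)) i~j)
      ... | inj₁ i→j = Succ⇒adj (toℕ i) (toℕ j) i→j
      ... | inj₂ j→i = trans (adj-sym G _ _) (Succ⇒adj (toℕ j) (toℕ i) j→i)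

      3≤n : 3 ≤ n
      3≤n = subst (3 ≤_) (sym n≡1+J) (s≤s 2≤J)

      -- Both adjacencies have degree 2 everywhere, so the inclusion cycleAdj ⊆ adj is an equality.
      trail-isCycle : IsCycle G
      trail-isCycle = 3≤n , ordering , λ i j → sym (count-mono-≡⇒≡ (cycleAdj⇒adj i) (degrees i) j)
        where
        degrees : ∀ i → count (cycleAdj n i) ≡ count (λ j → adj G (ordering ⟨$⟩ʳ i) (ordering ⟨$⟩ʳ j))
        degrees i = trans (cycleAdj-degree 3≤n i)
          (trans (sym (2-regular (ordering ⟨$⟩ʳ i)))
                 (∑-permute (λ w → χ (adj G (ordering ⟨$⟩ʳ i) w)) ordering))

    connected-2-regular⇒IsCycle : IsCycle G
    connected-2-regular⇒IsCycle with closed-trail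
    ... | J , inj , return = trail-isCycle J inj return

proposition2p1 : {n : ℕ} (G : Graph n) → Connected G → SelfCentered G → ¬ Complete G
    → (E₁ G ≤ E₂ G) × ((E₂ G ≡ E₁ G) ⇔ IsCycle G)
proposition2p1 {n} G connected self-centered incomplete = E₁≤E₂ , mk⇔ equality⇒cycle cycle⇒equality
  where
  d = diam G
  ecc≡d : ∀ v → ecc G v ≡ d
  ecc≡d = SelfCentered⇒ecc≡diam G self-centered
  2≤d : 2 ≤ d
  2≤d = 2≤diam G connected incomplete
  min-degree : ∀ v → 2 ≤ degree G v
  min-degree = min-degree-2 G connected ecc≡d 2≤d
  instance
    d*d-nonZero : NonZero (d * d)
    d*d-nonZero = >-nonZero (*-mono-≤ (≤-trans (s≤s z≤n) 2≤d) (≤-trans (s≤s z≤n) 2≤d))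
  E₁≡ : E₁ G ≡ n * (d * d)
  E₁≡ = E₁-constant G ecc≡d
  E₂≡ : E₂ G ≡ edgeCount G * (d * d)
  E₂≡ = E₂-constant G ecc≡d
  E₁≤E₂ : E₁ G ≤ E₂ G
  E₁≤E₂ = subst₂ _≤_ (sym E₁≡) (sym E₂≡) (*-monoˡ-≤ (d * d) (order≤edgeCount G min-degree))
  equality⇒cycle : E₂ G ≡ E₁ G → IsCycle G
  equality⇒cycle E₂≡E₁ = connected-2-regular⇒IsCycle 2-regular connected v
    where
    v = proj₁ (nonadjacent-pair G incomplete)
    2-regular = edgeCount≡order⇒2-regular G min-degree
                  (*-cancelʳ-≡ (edgeCount G) n (d * d) (trans (sym E₂≡) (trans E₂≡E₁ E₁≡)))
  cycle⇒equality : IsCycle G → E₂ G ≡ E₁ G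
  cycle⇒equality cycle = trans E₂≡ (trans (cong (_* (d * d)) edgeCount≡n) (sym E₁≡))
    where
    edgeCount≡n = 2-regular⇒edgeCount≡order G (IsCycle⇒2-regular G cycle)
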